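{- If $G$ is a digraph such that $V(G)$ can be partitioned into two minimum dominating sets, then $\gamma(G\mathbin{\Box} C_4^{(0,2,0,2)})=\gamma(G)\gamma(C_4^{(0,2,0,2)})$.
   Context: All digraphs are finite, and their arc relation is irreflexive. A set $S\subseteq V(D)$ is dominating if every vertex not in $S$ is an out-neighbor of some vertex of $S$; $\gamma(D)$ is the minimum size of a dominating set, and a minimum dominating set is a dominating set of size $\gamma(D)$. $C_4^{(0,2,0,2)}$ is the digraph with vertices $u,p,v,q$ and exactly the arcs $up,uq,vp,vq$. The Cartesian product $G\mathbin{\Box} H$ has vertex set $V(G)\times V(H)$, with an arc from $(g_1,h_1)$ to $(g_2,h_2)$ iff either $g_1=g_2$ and $h_1h_2\in A(H)$, or $h_1=h_2$ and $g_1g_2\in A(G)$. -}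

module Defs where

open import Data.Nat using (ℕ; _*_; _≤_)
open import Data.Fin using (Fin; zero; suc; remQuot)
open import Data.Fin.Subset using (Subset; _∈_; _∉_; ∣_∣; ∁)
open import Data.Product using (Σ; ∃; _×_; _,_; proj₁; proj₂)
open import Data.Sum using (_⊎_; inj₁; inj₂)
open import Relation.Binary.PropositionalEquality using (_≡_)
open import Relation.Nullary using (¬_)

record Digraph : Set₁ where
  field
    n     : ℕ
    Arc   : Fin n → Fin n → Set
    irrefl : ∀ v → ¬ Arc v v
open Digraph public

Dominating : (D : Digraph) → Subset (n D) → Set
Dominating D S = ∀ v → v ∉ S → ∃ λ u → u ∈ S × Arc D u v

IsDomNumber : Digraph → ℕ → Set
IsDomNumber D k =
  (∃ λ S → Dominating D S × ∣ S ∣ ≡ k) ×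
  (∀ S → Dominating D S → k ≤ ∣ S ∣)

MinDominating : (D : Digraph) → Subset (n D) → Set
MinDominating D S = Dominating D S × (∀ T → Dominating D T → ∣ S ∣ ≤ ∣ T ∣)

PartitionTwoMinDom : Digraph → Set
PartitionTwoMinDom D = ∃ λ S → MinDominating D S × MinDominating D (∁ S)

-- Cartesian product; vertex (g , h) is encoded as combine g h : Fin (n G * n H).
ProdArc : (G H : Digraph) → Fin (n G * n H) → Fin (n G * n H) → Set
ProdArc G H x y =
  (proj₁ (remQuot {n G} (n H) x) ≡ proj₁ (remQuot {n G} (n H) y)
     × Arc H (proj₂ (remQuot {n G} (n H) x)) (proj₂ (remQuot {n G} (n H) y)))
  ⊎ (proj₂ (remQuot {n G} (n H) x) ≡ proj₂ (remQuot {n G} (n H) y)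
     × Arc G (proj₁ (remQuot {n G} (n H) x)) (proj₁ (remQuot {n G} (n H) y)))

prodIrrefl : (G H : Digraph) → ∀ x → ¬ ProdArc G H x x
prodIrrefl G H x (inj₁ (_ , a)) = irrefl H _ a
prodIrrefl G H x (inj₂ (_ , a)) = irrefl G _ a

_□_ : Digraph → Digraph → Digraph
G □ H = record { n = n G * n H ; Arc = ProdArc G H ; irrefl = prodIrrefl G H }

-- C₄^(0,2,0,2): vertices u=0, p=1, v=2, q=3; arcs exactly up, uq, vp, vq.
data C4Arc : Fin 4 → Fin 4 → Set where
  up : C4Arc zero (suc zero)
  uq : C4Arc zero (suc (suc (suc zero)))
  vp : C4Arc (suc (suc zero)) (suc zero)
  vq : C4Arc (suc (suc zero)) (suc (suc (suc zero)))

C4-irrefl : ∀ v → ¬ C4Arc v v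
C4-irrefl _ ()

C4-0202 : Digraph
C4-0202 = record { n = 4 ; Arc = C4Arc ; irrefl = C4-irrefl }

-- If h is a vertex of H without in-arcs, a vertex (g , h) can only be dominated from its own
-- copy G × {h}, so every dominating set of G □ H meets G × {h} in a dominating set of G.
-- C₄^(0,2,0,2) has two such vertices u and v, whence γ(G □ C₄) ≥ 2γ(G). Conversely, if S and
-- its complement are minimum dominating sets of G, then S × {u} ∪ (V(G) ∖ S) × {v} dominates
-- G □ C₄, since p and q are out-neighbours of both u and v. Finally γ(C₄) = 2, because both
-- sources lie in every dominating set.
module Submission where

open import Defs
open import Data.Bool using (Bool; if_then_else_)
open import Data.Nat using (ℕ; suc; _*_; _+_; _≤_; z≤n; s≤s)
open import Data.Nat.Properties
  using (≤-reflexive; ≤-trans; ≤-antisym; +-comm; +-suc; +-identityʳ; *-comm; +-mono-≤; +-monoʳ-≤;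
         m≤m+n; n≤1+n; +-commutativeSemigroup; module ≤-Reasoning)
open import Algebra.Properties.CommutativeSemigroup +-commutativeSemigroup using (interchange)
open import Data.Fin using (Fin; zero; suc; combine; remQuot)
open import Data.Fin.Properties using (remQuot-combine; combine-remQuot)
open import Data.Fin.Subset using (Subset; _∈_; _∉_; ∣_∣; ∁; _∪_; ⁅_⁆; ⊥; inside; outside)
open import Data.Fin.Subset.Properties
  using (_∈?_; x∉p⇒x∈∁p; x∈⁅x⁆; ∣⁅x⁆∣≡1; ∣⊥∣≡0; ∣p∣≤∣x∷p∣; x∈p∪q⁺)
open import Data.Vec using (Vec; []; _∷_; _++_; concat; map; lookup; tabulate; group; here; there)
open import Data.Vec.Properties
  using (lookup-concat; lookup-map; lookup∘tabulate; tabulate∘lookup; tabulate-∘; tabulate-cong;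
         []=⇒lookup; lookup⇒[]=)
open import Data.Product using (∃; _×_; _,_; proj₁; proj₂)
open import Data.Sum using (_⊎_; inj₁; inj₂)
open import Relation.Nullary using (¬_; yes; no; contradiction)
open import Relation.Binary.PropositionalEquality
  using (_≡_; _≢_; refl; sym; trans; cong; cong₂; subst; subst₂; module ≡-Reasoning)

∣x∷p∣≡∣x∷[]∣+∣p∣ : ∀ {n} x (p : Subset n) → ∣ x ∷ p ∣ ≡ ∣ x ∷ [] ∣ + ∣ p ∣
∣x∷p∣≡∣x∷[]∣+∣p∣ inside  p = refl
∣x∷p∣≡∣x∷[]∣+∣p∣ outside p = refl

∣p++q∣≡∣p∣+∣q∣ : ∀ {m n} (p : Subset m) (q : Subset n) → ∣ p ++ q ∣ ≡ ∣ p ∣ + ∣ q ∣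
∣p++q∣≡∣p∣+∣q∣ []            q = refl
∣p++q∣≡∣p∣+∣q∣ (inside ∷ p)  q = cong suc (∣p++q∣≡∣p∣+∣q∣ p q)
∣p++q∣≡∣p∣+∣q∣ (outside ∷ p) q = ∣p++q∣≡∣p∣+∣q∣ p q

∣p∪q∣≤∣p∣+∣q∣ : ∀ {n} (p q : Subset n) → ∣ p ∪ q ∣ ≤ ∣ p ∣ + ∣ q ∣
∣p∪q∣≤∣p∣+∣q∣ []            []            = z≤n
∣p∪q∣≤∣p∣+∣q∣ (inside ∷ p)  (inside ∷ q)  =
  s≤s (≤-trans (∣p∪q∣≤∣p∣+∣q∣ p q) (+-monoʳ-≤ ∣ p ∣ (n≤1+n ∣ q ∣)))
∣p∪q∣≤∣p∣+∣q∣ (inside ∷ p)  (outside ∷ q) = s≤s (∣p∪q∣≤∣p∣+∣q∣ p q)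
∣p∪q∣≤∣p∣+∣q∣ (outside ∷ p) (inside ∷ q)  =
  subst (suc ∣ p ∪ q ∣ ≤_) (sym (+-suc ∣ p ∣ ∣ q ∣)) (s≤s (∣p∪q∣≤∣p∣+∣q∣ p q))
∣p∪q∣≤∣p∣+∣q∣ (outside ∷ p) (outside ∷ q) = ∣p∪q∣≤∣p∣+∣q∣ p q

∣p[i]∣≤∣p∣ : ∀ {n} (p : Subset n) i → ∣ lookup p i ∷ [] ∣ ≤ ∣ p ∣
∣p[i]∣≤∣p∣ (x ∷ p) zero    =
  subst (∣ x ∷ [] ∣ ≤_) (sym (∣x∷p∣≡∣x∷[]∣+∣p∣ x p)) (m≤m+n ∣ x ∷ [] ∣ ∣ p ∣)
∣p[i]∣≤∣p∣ (x ∷ p) (suc i) = ≤-trans (∣p[i]∣≤∣p∣ p i) (∣p∣≤∣x∷p∣ x p)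

∣p[i]∣+∣p[j]∣≤∣p∣ : ∀ {n} (p : Subset n) {i j} → i ≢ j →
                    ∣ lookup p i ∷ [] ∣ + ∣ lookup p j ∷ [] ∣ ≤ ∣ p ∣
∣p[i]∣+∣p[j]∣≤∣p∣ (x ∷ p) {zero}  {zero}  i≢j = contradiction refl i≢j
∣p[i]∣+∣p[j]∣≤∣p∣ (x ∷ p) {zero}  {suc j} _   =
  subst (∣ x ∷ [] ∣ + ∣ lookup p j ∷ [] ∣ ≤_) (sym (∣x∷p∣≡∣x∷[]∣+∣p∣ x p))
        (+-monoʳ-≤ ∣ x ∷ [] ∣ (∣p[i]∣≤∣p∣ p j))
∣p[i]∣+∣p[j]∣≤∣p∣ (x ∷ p) {suc i} {zero}  _   =
  subst₂ _≤_ (+-comm ∣ x ∷ [] ∣ ∣ lookup p i ∷ [] ∣) (sym (∣x∷p∣≡∣x∷[]∣+∣p∣ x p))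
         (+-monoʳ-≤ ∣ x ∷ [] ∣ (∣p[i]∣≤∣p∣ p i))
∣p[i]∣+∣p[j]∣≤∣p∣ (x ∷ p) {suc i} {suc j} i≢j =
  ≤-trans (∣p[i]∣+∣p[j]∣≤∣p∣ p (λ i≡j → i≢j (cong suc i≡j))) (∣p∣≤∣x∷p∣ x p)

two-elements⇒2≤∣p∣ : ∀ {n} {p : Subset n} {i j} → i ≢ j → i ∈ p → j ∈ p → 2 ≤ ∣ p ∣
two-elements⇒2≤∣p∣ {p = p} i≢j i∈p j∈p =
  subst₂ (λ x y → ∣ x ∷ [] ∣ + ∣ y ∷ [] ∣ ≤ ∣ p ∣) ([]=⇒lookup i∈p) ([]=⇒lookup j∈p)
         (∣p[i]∣+∣p[j]∣≤∣p∣ p i≢j)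

-- The vertex (g , h) of G □ H is combine g h, so a subset of Fin (m * k) is the concatenation
-- of m rows of length k; layer h D is D ∩ (G × {h}) and place h S is S × {h}.
module ProductSubsets (m k : ℕ) where

  layer : Fin k → Subset (m * k) → Subset m
  layer h D = tabulate λ g → lookup D (combine g h)

  combine∈⇒∈layer : ∀ {g h} (D : Subset (m * k)) → combine g h ∈ D → g ∈ layer h D
  combine∈⇒∈layer {g} {h} D gh∈D =
    lookup⇒[]= g (layer h D) (trans (lookup∘tabulate _ g) ([]=⇒lookup gh∈D))

  column : ∀ {n} → Fin k → Vec (Subset k) n → Subset n
  column h = map (λ r → lookup r h)

  layer-concat : ∀ h (rs : Vec (Subset k) m) → layer h (concat rs) ≡ column h rs
  layer-concat h rs = begin
    tabulate (λ g → lookup (concat rs) (combine g h)) ≡⟨ tabulate-cong (λ g → lookup-concat rs g h) ⟩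
    tabulate (λ g → lookup (lookup rs g) h)           ≡⟨ tabulate-∘ (λ r → lookup r h) (lookup rs) ⟩
    map (λ r → lookup r h) (tabulate (lookup rs))     ≡⟨ cong (map (λ r → lookup r h)) (tabulate∘lookup rs) ⟩
    map (λ r → lookup r h) rs                         ∎
    where open ≡-Reasoning

  ∣layer∣+∣layer∣≤∣D∣ : ∀ {h h′} → h ≢ h′ → (D : Subset (m * k)) →
                      ∣ layer h D ∣ + ∣ layer h′ D ∣ ≤ ∣ D ∣
  ∣layer∣+∣layer∣≤∣D∣ {h} {h′} h≢h′ D with group m k D
  ... | rs , refl rewrite layer-concat h rs | layer-concat h′ rs = rows rs
    where
    rows : ∀ {m} (rs : Vec (Subset k) m) →
           ∣ column h rs ∣ + ∣ column h′ rs ∣ ≤ ∣ concat rs ∣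
    rows []       = z≤n
    rows (r ∷ rs) = begin
      ∣ column h (r ∷ rs) ∣ + ∣ column h′ (r ∷ rs) ∣
        ≡⟨ cong₂ _+_ (∣x∷p∣≡∣x∷[]∣+∣p∣ (lookup r h) (column h rs))
                     (∣x∷p∣≡∣x∷[]∣+∣p∣ (lookup r h′) (column h′ rs)) ⟩
      (∣ lookup r h ∷ [] ∣ + ∣ column h rs ∣) + (∣ lookup r h′ ∷ [] ∣ + ∣ column h′ rs ∣)
        ≡⟨ interchange (∣ lookup r h ∷ [] ∣) _ (∣ lookup r h′ ∷ [] ∣) _ ⟩
      (∣ lookup r h ∷ [] ∣ + ∣ lookup r h′ ∷ [] ∣) + (∣ column h rs ∣ + ∣ column h′ rs ∣)
        ≤⟨ +-mono-≤ (∣p[i]∣+∣p[j]∣≤∣p∣ r h≢h′) (rows rs) ⟩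
      ∣ r ∣ + ∣ concat rs ∣
        ≡⟨ ∣p++q∣≡∣p∣+∣q∣ r (concat rs) ⟨
      ∣ r ++ concat rs ∣ ∎
      where open ≤-Reasoning

place-row : ∀ {k} → Fin k → Bool → Subset k
place-row h s = if s then ⁅ h ⁆ else ⊥

place : ∀ {m k} → Fin k → Subset m → Subset (m * k)
place h S = concat (map (place-row h) S)

∣place∣≡∣S∣ : ∀ {m k} (h : Fin k) (S : Subset m) → ∣ place h S ∣ ≡ ∣ S ∣
∣place∣≡∣S∣ h []            = refl
∣place∣≡∣S∣ h (inside ∷ S)  =
  trans (∣p++q∣≡∣p∣+∣q∣ ⁅ h ⁆ (place h S)) (cong₂ _+_ (∣⁅x⁆∣≡1 h) (∣place∣≡∣S∣ h S))
∣place∣≡∣S∣ {k = k} h (outside ∷ S) =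
  trans (∣p++q∣≡∣p∣+∣q∣ (⊥ {k}) (place h S)) (cong₂ _+_ (∣⊥∣≡0 k) (∣place∣≡∣S∣ h S))

∈⇒combine∈place : ∀ {m k} {g : Fin m} (h : Fin k) (S : Subset m) → g ∈ S → combine g h ∈ place h S
∈⇒combine∈place {g = g} h S g∈S = lookup⇒[]= (combine g h) (place h S) (begin
  lookup (place h S) (combine g h)           ≡⟨ lookup-concat (map (place-row h) S) g h ⟩
  lookup (lookup (map (place-row h) S) g) h  ≡⟨ cong (λ r → lookup r h) (lookup-map g (place-row h) S) ⟩
  lookup (place-row h (lookup S g)) h        ≡⟨ cong (λ s → lookup (place-row h s) h) ([]=⇒lookup g∈S) ⟩
  lookup ⁅ h ⁆ h                             ≡⟨ []=⇒lookup (x∈⁅x⁆ h) ⟩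
  inside                                     ∎)
  where open ≡-Reasoning

IsDomNumber-unique : ∀ {D a b} → IsDomNumber D a → IsDomNumber D b → a ≡ b
IsDomNumber-unique ((S , domS , refl) , a≤) ((T , domT , refl) , b≤) = ≤-antisym (a≤ T domT) (b≤ S domS)

MinDominating⇒∣S∣≡γ : ∀ {D a S} → IsDomNumber D a → MinDominating D S → ∣ S ∣ ≡ a
MinDominating⇒∣S∣≡γ ((W , domW , refl) , a≤) (domS , minS) = ≤-antisym (minS W domW) (a≤ _ domS)

IsSource : (H : Digraph) → Fin (n H) → Set
IsSource H h = ∀ h′ → ¬ Arc H h′ h

source∈dominating : ∀ {H h S} → IsSource H h → Dominating H S → h ∈ S
source∈dominating {h = h} {S} src domS with h ∈? S
... | yes h∈S = h∈S
... | no  h∉S with domS h h∉S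
...   | _ , _ , arc = contradiction arc (src _)

two-sources⇒2≤γ : ∀ {H u v} → IsSource H u → IsSource H v → u ≢ v → ∀ S → Dominating H S → 2 ≤ ∣ S ∣
two-sources⇒2≤γ {H} srcU srcV u≢v S domS =
  two-elements⇒2≤∣p∣ u≢v (source∈dominating {H} srcU domS) (source∈dominating {H} srcV domS)

module _ (G H : Digraph) where
  open ProductSubsets (n G) (n H)

  -- ProdArc G H x y is definitionally PairArc (remQuot x) (remQuot y).
  PairArc : Fin (n G) × Fin (n H) → Fin (n G) × Fin (n H) → Set
  PairArc (g , h) (g′ , h′) = (g ≡ g′ × Arc H h h′) ⊎ (h ≡ h′ × Arc G g g′)

  □-arc : ∀ {g h g′ h′} → PairArc (g , h) (g′ , h′) → Arc (G □ H) (combine g h) (combine g′ h′)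
  □-arc {g} {h} {g′} {h′} =
    subst₂ PairArc (sym (remQuot-combine {n G} g h)) (sym (remQuot-combine {n G} g′ h′))

  □-arc-into-source : ∀ {x g h} → IsSource H h → Arc (G □ H) x (combine g h) →
                      ∃ λ g′ → x ≡ combine g′ h × Arc G g′ g
  □-arc-into-source {x} {g} {h} src arc
    with subst (PairArc (remQuot {n G} (n H) x)) (remQuot-combine {n G} g h) arc
  ... | inj₁ (_ , arcH)    = contradiction arcH (src _)
  ... | inj₂ (refl , arcG) = proj₁ (remQuot {n G} (n H) x) , sym (combine-remQuot {n G} (n H) x) , arcG

  layer-dominating : ∀ {h} → IsSource H h → (D : Subset (n G * n H)) →
                     Dominating (G □ H) D → Dominating G (layer h D)
  layer-dominating {h} src D domD g g∉layer
    with domD (combine g h) (λ gh∈D → g∉layer (combine∈⇒∈layer D gh∈D))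
  ... | x , x∈D , arc with □-arc-into-source src arc
  ...   | g′ , refl , arcG = g′ , combine∈⇒∈layer D x∈D , arcG

  two-sources⇒γ+γ≤∣D∣ : ∀ {a u v} → IsSource H u → IsSource H v → u ≢ v →
                        (∀ S → Dominating G S → a ≤ ∣ S ∣) →
                        ∀ D → Dominating (G □ H) D → a + a ≤ ∣ D ∣
  two-sources⇒γ+γ≤∣D∣ srcU srcV u≢v γ≤ D domD =
    ≤-trans (+-mono-≤ (γ≤ _ (layer-dominating srcU D domD)) (γ≤ _ (layer-dominating srcV D domD)))
            (∣layer∣+∣layer∣≤∣D∣ u≢v D)

  place-dominating : ∀ {u v S} → (∀ w → w ≡ u ⊎ w ≡ v ⊎ (Arc H u w × Arc H v w)) →
                     Dominating G S → Dominating G (∁ S) →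
                     Dominating (G □ H) (place u S ∪ place v (∁ S))
  place-dominating {u} {v} {S} cover domS dom∁S x =
    subst (λ y → y ∉ B → ∃ λ z → z ∈ B × Arc (G □ H) z y)
          (combine-remQuot {n G} (n H) x) (dominate _ _)
    where
    B : Subset (n G * n H)
    B = place u S ∪ place v (∁ S)

    ∈ᵤB : ∀ {g} → g ∈ S → combine g u ∈ B
    ∈ᵤB g∈S = x∈p∪q⁺ (inj₁ (∈⇒combine∈place u S g∈S))

    ∈ᵥB : ∀ {g} → g ∈ ∁ S → combine g v ∈ B
    ∈ᵥB g∈∁S = x∈p∪q⁺ (inj₂ (∈⇒combine∈place v (∁ S) g∈∁S))

    dominate : ∀ g w → combine g w ∉ B → ∃ λ z → z ∈ B × Arc (G □ H) z (combine g w)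
    dominate g w gw∉B with cover w
    ... | inj₁ refl with domS g (λ g∈S → gw∉B (∈ᵤB g∈S))
    ...   | g′ , g′∈S , arc = combine g′ u , ∈ᵤB g′∈S , □-arc (inj₂ (refl , arc))
    dominate g w gw∉B | inj₂ (inj₁ refl) with dom∁S g (λ g∈∁S → gw∉B (∈ᵥB g∈∁S))
    ...   | g′ , g′∈∁S , arc = combine g′ v , ∈ᵥB g′∈∁S , □-arc (inj₂ (refl , arc))
    dominate g w gw∉B | inj₂ (inj₂ (u→w , v→w)) with g ∈? S
    ...   | yes g∈S = combine g u , ∈ᵤB g∈S , □-arc (inj₁ (refl , u→w))
    ...   | no  g∉S = combine g v , ∈ᵥB (x∉p⇒x∈∁p g∉S) , □-arc (inj₁ (refl , v→w))

  γ-□-two-sources : ∀ {a u v} → IsSource H u → IsSource H v → u ≢ v →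
                    (∀ w → w ≡ u ⊎ w ≡ v ⊎ (Arc H u w × Arc H v w)) →
                    PartitionTwoMinDom G → IsDomNumber G a → IsDomNumber (G □ H) (a + a)
  γ-□-two-sources {a} {u} {v} srcU srcV u≢v cover (S , minS , min∁S) γG =
    (B , domB , ≤-antisym ∣B∣≤a+a (γ+γ≤ B domB)) , γ+γ≤
    where
    B : Subset (n G * n H)
    B = place u S ∪ place v (∁ S)

    domB : Dominating (G □ H) B
    domB = place-dominating cover (proj₁ minS) (proj₁ min∁S)

    γ+γ≤ : ∀ D → Dominating (G □ H) D → a + a ≤ ∣ D ∣
    γ+γ≤ = two-sources⇒γ+γ≤∣D∣ srcU srcV u≢v (proj₂ γG)

    ∣B∣≤a+a : ∣ B ∣ ≤ a + a
    ∣B∣≤a+a = ≤-trans (∣p∪q∣≤∣p∣+∣q∣ (place u S) (place v (∁ S)))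
      (≤-reflexive (cong₂ _+_ (trans (∣place∣≡∣S∣ u S) (MinDominating⇒∣S∣≡γ {G} γG minS))
                              (trans (∣place∣≡∣S∣ v (∁ S)) (MinDominating⇒∣S∣≡γ {G} γG min∁S))))

C4-source-u : IsSource C4-0202 zero
C4-source-u _ ()

C4-source-v : IsSource C4-0202 (suc (suc zero))
C4-source-v _ ()

C4-cover : ∀ w → w ≡ zero ⊎ w ≡ suc (suc zero) ⊎ (C4Arc zero w × C4Arc (suc (suc zero)) w)
C4-cover zero                   = inj₁ refl
C4-cover (suc zero)             = inj₂ (inj₂ (up , vp))
C4-cover (suc (suc zero))       = inj₂ (inj₁ refl)
C4-cover (suc (suc (suc zero))) = inj₂ (inj₂ (uq , vq))

γ-C4 : IsDomNumber C4-0202 2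
γ-C4 = (inside ∷ outside ∷ inside ∷ outside ∷ [] , dom , refl)
     , two-sources⇒2≤γ {C4-0202} C4-source-u C4-source-v (λ ())
  where
  dom : Dominating C4-0202 (inside ∷ outside ∷ inside ∷ outside ∷ [])
  dom zero                   0∉ = contradiction here 0∉
  dom (suc zero)             _  = zero , here , up
  dom (suc (suc zero))       2∉ = contradiction (there (there here)) 2∉
  dom (suc (suc (suc zero))) _  = zero , here , uq

proposition7p2 : (G : Digraph) → PartitionTwoMinDom G →
    (a b : ℕ) → IsDomNumber G a → IsDomNumber C4-0202 b →
    IsDomNumber (G □ C4-0202) (a * b)
proposition7p2 G partition a b γG γC4 =
  subst (IsDomNumber (G □ C4-0202)) a+a≡a*b
        (γ-□-two-sources G C4-0202 C4-source-u C4-source-v (λ ()) C4-cover partition γG)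
  where
  open ≡-Reasoning
  a+a≡a*b : a + a ≡ a * b
  a+a≡a*b = begin
    a + a       ≡⟨ cong (a +_) (+-identityʳ a) ⟨
    a + (a + 0) ≡⟨ *-comm 2 a ⟩
    a * 2       ≡⟨ cong (a *_) (IsDomNumber-unique {C4-0202} γ-C4 γC4) ⟩
    a * b       ∎
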